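{- Let $A:\mathsf{U}$ and $B:A\to\mathsf{U}$, and let $P$ be the associated polynomial functor. For every small $P$-algebra $C=(C,\sup_C)$, $C$ is inductive if and only if $C$ is homotopy-initial. That is, the type $(\Pi C:\mathsf{Alg})\big(\mathsf{isind}(C)\leftrightarrow\mathsf{ishinit}(C)\big)$ is inhabited, where $X\leftrightarrow Y$ denotes $(X\to Y)\times(Y\to X)$.
   Context: Work in the intensional Martin-Löf type theory $\mathcal{H}$ with $\Sigma$-types, $\Pi$-types (with the judgemental $\eta$-rule $f=(\lambda x)f(x)$), identity types $\mathsf{Id}_A(a,b)$ and a universe $\mathsf{U}$ (à la Russell) closed under $\Sigma$, $\Pi$ and $\mathsf{Id}$, together with function extensionality: every family $\alpha_x:\mathsf{Id}_{B(x)}(fx,gx)$ gives a path $\mathsf{Id}(f,g)$. No uniqueness of identity proofs or equality reflection is assumed. Elements of identity types are called paths; a type $X$ is contractible if $\mathsf{iscontr}(X):=(\Sigma x:X)(\Pi y:X)\mathsf{Id}_X(x,y)$ is inhabited. Types in $\mathsf{U}$ are called small. Polynomial functor: fix $A:\mathsf{U}$, $B:A\to\mathsf{U}$. For $C:\mathsf{U}$ put $PC:=(\Sigma x:A)(B(x)\to C)$, and for $f:C\to D$ let $Pf:PC\to PD$ be defined by $\Sigma$-elimination with $Pf(x,u)=(x,f\circ u)$. A (small) $P$-algebra is a pair $(C,\sup_C)$ with $C:\mathsf{U}$ and $\sup_C:PC\to C$; $\mathsf{Alg}:=(\Sigma C:\mathsf{U})(PC\to C)$. A $P$-algebra morphism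 $(C,\sup_C)\to(D,\sup_D)$ is a pair $(f,\bar f)$ with $f:C\to D$ and $\bar f:\mathsf{Id}(f\circ\sup_C,\sup_D\circ Pf)$; $\mathsf{Alg}(C,D):=(\Sigma f:C\to D)\,\mathsf{Id}(f\circ\sup_C,\sup_D\circ Pf)$. $C$ is homotopy-initial if $\mathsf{ishinit}(C):=(\Pi D:\mathsf{Alg})\,\mathsf{iscontr}(\mathsf{Alg}(C,D))$ is inhabited. A fibered $P$-algebra over $C$ is a pair $(E,e)$ with $E:C\to\mathsf{U}$ and $e:(\Pi x:A)(\Pi u:B(x)\to C)\big((\Pi y:B(x))E(uy)\big)\to E(\sup_C(x,u))$; $\mathsf{FibAlg}(C)$ is the type of these. A $P$-algebra section of $(E,e)$ is a pair $(f,\bar f)$ with $f:(\Pi z:C)E(z)$ and $\bar f$ a witness that for all $x:A$, $u:B(x)\to C$, $\mathsf{Id}_{E(\sup_C(x,u))}\big(f(\sup_C(x,u)),\,e(x,u,\lambda y.f(uy))\big)$; $\mathsf{AlgSec}(C,E)$ is the type of these. $C$ is inductive if $\mathsf{isind}(C):=(\Pi E:\mathsf{FibAlg}(C))\,\mathsf{AlgSec}(C,E)$ is inhabited. -}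

{-# OPTIONS --without-K #-}
module Defs where

-- Type theory H: universe U = Set (à la Russell), Id = _≡_ (no K, no UIP).
open import Data.Product using (Σ; _×_; _,_; proj₁; proj₂)
open import Relation.Binary.PropositionalEquality using (_≡_)

-- Function extensionality (for dependent functions between small types),
-- an axiom of H; taken as a hypothesis of the theorem.
FunExt : Set₁
FunExt = {X : Set} {Y : X → Set} {f g : (x : X) → Y x}
       → ((x : X) → f x ≡ g x) → f ≡ g

iscontr : Set → Set
iscontr X = Σ X (λ x → (y : X) → x ≡ y)

_↔_ : Set₁ → Set₁ → Set₁
X ↔ Y = (X → Y) × (Y → X)

module Poly (A : Set) (B : A → Set) where

  P₀ : Set → Set
  P₀ C = Σ A (λ x → B x → C)

  P₁ : {C D : Set} → (C → D) → P₀ C → P₀ D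
  P₁ f (x , u) = (x , λ y → f (u y))

  Alg : Set₁
  Alg = Σ Set (λ C → P₀ C → C)

  AlgHom : Alg → Alg → Set
  AlgHom (C , supC) (D , supD) =
    Σ (C → D) (λ f → (λ w → f (supC w)) ≡ (λ w → supD (P₁ f w)))

  ishinit : Alg → Set₁
  ishinit C = (D : Alg) → iscontr (AlgHom C D)

  FibAlg : Alg → Set₁
  FibAlg (C , supC) =
    Σ (C → Set) (λ E →
      (x : A) (u : B x → C) → ((y : B x) → E (u y)) → E (supC (x , u)))

  AlgSec : (C : Alg) → FibAlg C → Set
  AlgSec (C , supC) (E , e) =
    Σ ((z : C) → E z) (λ f →
      (x : A) (u : B x → C) → f (supC (x , u)) ≡ e x u (λ y → f (u y)))

  isind : Alg → Set₁
  isind C = (E : FibAlg C) → AlgSec C E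

{-# OPTIONS --without-K #-}
module Submission where

-- The constant fibered algebra over C with fibre D has as sections exactly the
-- algebra morphisms C → D (with the commuting square read pointwise), so
-- morphisms form a retract of sections. If C is inductive, sections of every
-- fibered algebra are unique up to a path: two sections are joined by a
-- section of the fibered algebra of their pointwise paths, and homotopy
-- induction turns such a section into a path of sections. Hence morphism
-- types out of C are contractible. Conversely, if C is homotopy-initial, the
-- morphism C → Σ C E composed with the first projection is an endomorphism of
-- C, hence equal to the identity; transporting the second components along
-- this equality yields a section of E.

open import Defs
open import Data.Product using (Σ; _,_; proj₁; proj₂; uncurry)
open import Relation.Binary.PropositionalEquality
  using (_≡_; refl; sym; trans; cong; cong-app; subst; module ≡-Reasoning)
open import Relation.Binary.PropositionalEquality.Properties
  using (trans-symˡ; trans-symʳ; trans-injectiveˡ)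

infix 4 _∼_

_∼_ : {X : Set} {Y : X → Set} (f g : (x : X) → Y x) → Set
f ∼ g = ∀ x → f x ≡ g x

iscontr⇒≡ : {X : Set} → iscontr X → (a b : X) → a ≡ b
iscontr⇒≡ (c , h) a b = trans (sym (h a)) (h b)

iscontr-retract : {X Y : Set} (r : X → Y) (s : Y → X)
  → (∀ y → r (s y) ≡ y) → iscontr X → iscontr Y
iscontr-retract r s rs (c , h) = r c , λ y → trans (cong r (h (s y))) (rs y)

iscontr-singleton : {Z : Set} (a : Z) → iscontr (Σ Z (λ b → a ≡ b))
iscontr-singleton a = (a , refl) , λ { (b , refl) → refl }

trans-sym≡refl⇒≡ : {Z : Set} {a b : Z} (p q : a ≡ b) → trans p (sym q) ≡ refl → p ≡ q
trans-sym≡refl⇒≡ p q r = trans-injectiveˡ (sym q) (trans r (sym (trans-symʳ q)))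

cong-app-cong-∘ : {X Y Z : Set} (g : Y → Z) {F G : X → Y} (p : F ≡ G) (w : X)
  → cong-app (cong (λ H v → g (H v)) p) w ≡ cong g (cong-app p w)
cong-app-cong-∘ g refl w = refl

subst-cong-proj₁ : {X : Set} (E : X → Set) {a b : Σ X E} (p : a ≡ b)
  → subst E (cong proj₁ p) (proj₂ a) ≡ proj₂ b
subst-cong-proj₁ E refl = refl

module Funext (fe : FunExt) where

  -- fe need not send the trivial homotopy to refl; this corrected version does.
  funext : {X : Set} {Y : X → Set} {f g : (x : X) → Y x} → f ∼ g → f ≡ g
  funext {f = f} h = trans (sym (fe {f = f} (λ _ → refl))) (fe h)

  funext-refl : {X : Set} {Y : X → Set} (f : (x : X) → Y x)
    → funext {f = f} (λ _ → refl) ≡ refl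
  funext-refl f = trans-symˡ (fe {f = f} (λ _ → refl))

  funext-cong-app : {X : Set} {Y : X → Set} {f g : (x : X) → Y x} (p : f ≡ g)
    → funext (cong-app p) ≡ p
  funext-cong-app {f = f} refl = funext-refl f

  iscontr-Π : {X : Set} {T : X → Set} → (∀ x → iscontr (T x)) → iscontr ((x : X) → T x)
  iscontr-Π c = (λ x → proj₁ (c x)) , λ φ → funext (λ x → proj₂ (c x) (φ x))

  iscontr-homotopies : {X : Set} {Y : X → Set} (f : (x : X) → Y x)
    → iscontr (Σ ((x : X) → Y x) (λ g → f ∼ g))
  iscontr-homotopies f =
    iscontr-retract (λ φ → (λ x → proj₁ (φ x)) , (λ x → proj₂ (φ x)))
                    (λ gk x → proj₁ gk x , proj₂ gk x)
                    (λ _ → refl)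
                    (iscontr-Π (λ x → iscontr-singleton (f x)))

  homotopy-ind : {X : Set} {Y : X → Set} (f : (x : X) → Y x)
    (Q : (g : (x : X) → Y x) → f ∼ g → Set)
    → Q f (λ _ → refl) → (g : (x : X) → Y x) (k : f ∼ g) → Q g k
  homotopy-ind f Q q₀ g k =
    subst (uncurry Q) (iscontr⇒≡ (iscontr-homotopies f) (f , λ _ → refl) (g , k)) q₀

module Algebras (fe : FunExt) (A : Set) (B : A → Set) (C : Set) (supC : Poly.P₀ A B C → C) where
  open Poly A B
  open Funext fe

  Cₐ : Alg
  Cₐ = C , supC

  constFib : Alg → FibAlg Cₐ
  constFib (D , supD) = (λ _ → D) , λ x u v → supD (x , v)

  hom→sec : (D : Alg) → AlgHom Cₐ D → AlgSec Cₐ (constFib D)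
  hom→sec (D , supD) (f , p) = f , λ x u → cong-app p (x , u)

  sec→hom : (D : Alg) → AlgSec Cₐ (constFib D) → AlgHom Cₐ D
  sec→hom (D , supD) (f , h) = f , funext (λ w → h (proj₁ w) (proj₂ w))

  sec→hom∘hom→sec : (D : Alg) (φ : AlgHom Cₐ D) → sec→hom D (hom→sec D φ) ≡ φ
  sec→hom∘hom→sec (D , supD) (f , p) = cong (f ,_) (funext-cong-app p)

  pathFibAlg : (E : FibAlg Cₐ) → AlgSec Cₐ E → AlgSec Cₐ E → FibAlg Cₐ
  pathFibAlg (E , e) (f , p) (g , q) = (λ z → f z ≡ g z) , λ x u H →
    trans (p x u) (trans (cong (e x u) (funext H)) (sym (q x u)))

  pathFibAlg-sec⇒≡ : (E : FibAlg Cₐ) (σ τ : AlgSec Cₐ E) → AlgSec Cₐ (pathFibAlg E σ τ) → σ ≡ τ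
  pathFibAlg-sec⇒≡ (E , e) (f , p) (g , q) (k , kp) = homotopy-ind f Q base g k q kp
    where
      Q : (g′ : (z : C) → E z) → f ∼ g′ → Set
      Q g′ k′ = (q′ : ∀ x u → g′ (supC (x , u)) ≡ e x u (λ y → g′ (u y)))
        → (∀ x u → k′ (supC (x , u))
                     ≡ proj₂ (pathFibAlg (E , e) (f , p) (g′ , q′)) x u (λ y → k′ (u y)))
        → _≡_ {A = AlgSec Cₐ (E , e)} (f , p) (g′ , q′)

      base : Q f (λ _ → refl)
      base q′ c = cong (f ,_) (funext λ x → funext λ u →
        trans-sym≡refl⇒≡ (p x u) (q′ x u) (sym (begin
          refl                                                                   ≡⟨ c x u ⟩
          trans (p x u) (trans (cong (e x u) (funext (λ y → refl))) (sym (q′ x u)))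
            ≡⟨ cong (λ r → trans (p x u) (trans (cong (e x u) r) (sym (q′ x u))))
                    (funext-refl (λ y → f (u y))) ⟩
          trans (p x u) (sym (q′ x u))                                            ∎)))
        where open ≡-Reasoning

  AlgSec-unique : isind Cₐ → (E : FibAlg Cₐ) (σ τ : AlgSec Cₐ E) → σ ≡ τ
  AlgSec-unique ind E σ τ = pathFibAlg-sec⇒≡ E σ τ (ind (pathFibAlg E σ τ))

  isind⇒ishinit : isind Cₐ → ishinit Cₐ
  isind⇒ishinit ind D =
    iscontr-retract (sec→hom D) (hom→sec D) (sec→hom∘hom→sec D)
      (ind (constFib D) , AlgSec-unique ind (constFib D) (ind (constFib D)))

  totalAlg : FibAlg Cₐ → Alg
  totalAlg (E , e) = Σ C E , λ w →
    supC (proj₁ w , λ y → proj₁ (proj₂ w y))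
    , e (proj₁ w) (λ y → proj₁ (proj₂ w y)) (λ y → proj₂ (proj₂ w y))

  proj₁-hom : (E : FibAlg Cₐ) → AlgHom Cₐ (totalAlg E) → AlgHom Cₐ Cₐ
  proj₁-hom (E , e) (h , hp) = (λ z → proj₁ (h z)) , cong (λ F w → proj₁ (F w)) hp

  -- SecOver E idSec is definitionally AlgSec Cₐ E.
  SecOver : FibAlg Cₐ → AlgSec Cₐ (constFib Cₐ) → Set
  SecOver (E , e) (k , kp) = Σ ((z : C) → E (k z)) λ g →
    ∀ x u → subst E (kp x u) (g (supC (x , u))) ≡ e x (λ y → k (u y)) (λ y → g (u y))

  idSec : AlgSec Cₐ (constFib Cₐ)
  idSec = (λ z → z) , λ x u → refl

  proj₂-secOver : (E : FibAlg Cₐ) (φ : AlgHom Cₐ (totalAlg E))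
    → SecOver E (hom→sec Cₐ (proj₁-hom E φ))
  proj₂-secOver (E , e) (h , hp) = (λ z → proj₂ (h z)) , λ x u →
    trans (cong (λ t → subst E t (proj₂ (h (supC (x , u))))) (cong-app-cong-∘ proj₁ hp (x , u)))
          (subst-cong-proj₁ E (cong-app hp (x , u)))

  ishinit⇒isind : ishinit Cₐ → isind Cₐ
  ishinit⇒isind hinit E = subst (SecOver E) proj₁∘φ≡id (proj₂-secOver E φ)
    where
      φ : AlgHom Cₐ (totalAlg E)
      φ = proj₁ (hinit (totalAlg E))

      proj₁∘φ≡id : hom→sec Cₐ (proj₁-hom E φ) ≡ idSec
      proj₁∘φ≡id = cong (hom→sec Cₐ) (iscontr⇒≡ (hinit Cₐ) (proj₁-hom E φ) ((λ z → z) , refl))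

theorem5p10 : FunExt → (A : Set) (B : A → Set) → (C : Poly.Alg A B)
    → Poly.isind A B C ↔ Poly.ishinit A B C
theorem5p10 fe A B (C , supC) = isind⇒ishinit , ishinit⇒isind
  where open Algebras fe A B C supC
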